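{- Define the sequence $c$ by $c(1)=2$ and, for $n\ge 2$, $$c(n)=c(n-1)+\begin{cases}\gcd(n,\,c(n-1)), & n \text{ even},\\ \gcd(n-2,\,c(n-1)), & n\text{ odd}.\end{cases}$$ Call $n$ a fundamental point if $c(n)=2n$, and list the fundamental points in increasing order as $m_1<m_2<\cdots$. For $i\ge 2$ with $m_i$ existing, let $\rho^{(i)}$ be the largest integer $n<m_i$ with $c(n)-c(n-1)>1$, and put $n_{i-1}=m_{i-1}+3$ and $\lambda_i=\rho^{(i)}/n_{i-1}$. Suppose (Conjecture 4) that for every $i\ge 6$ the fundamental point $m_i$ exists and $\lambda_i\le 5/4$. Then there are infinitely many twin primes. -}

module Defs where

open import Data.Nat using (ℕ; zero; suc; _+_; _*_; _∸_; _≤_; _<_; pred)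
open import Data.Nat.DivMod using (_%_)
open import Data.Nat.GCD using (gcd)
open import Data.Nat.Properties using (_≟_)
open import Data.Product using (_×_)
open import Relation.Nullary using (¬_; yes; no)
open import Relation.Binary.PropositionalEquality using (_≡_)

step : ℕ → ℕ → ℕ
step n prev with n % 2 ≟ 0
... | yes _ = prev + gcd n prev
... | no  _ = prev + gcd (n ∸ 2) prev

-- The sequence c, with c(1) = 2.  c(0) is a junk value (never used).
c : ℕ → ℕ
c zero = 0
c (suc zero) = 2
c (suc (suc k)) = step (suc (suc k)) (c (suc k))

Fund : ℕ → Set
Fund n = (1 ≤ n) × (c n ≡ 2 * n)

-- NthFund i m : m is the i-th fundamental point m_i (1-indexed, increasing order).
data NthFund : ℕ → ℕ → Set where
  first : ∀ {m} → Fund m → (∀ n → n < m → ¬ Fund n) → NthFund 1 m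
  next  : ∀ {i m′ m} → NthFund i m′ → m′ < m → Fund m →
          (∀ n → m′ < n → n < m → ¬ Fund n) → NthFund (suc i) m

Jump : ℕ → Set
Jump n = 1 < c n ∸ c (pred n)

IsRho : ℕ → ℕ → Set
IsRho m r = (2 ≤ r) × (r < m) × Jump r × (∀ n → r < n → n < m → ¬ Jump n)

-- Let M be a good fundamental point: c(M) = 2M, M even and 3 ∤ M + 2.  The recurrence is
-- then forced for three steps, c(M+1) = 2M+1, c(M+2) = 2M+2, c(M+3) = 3M+3, so the next
-- fundamental point m lies beyond M + 3 and the last jump ρ before m is at least M + 3.
-- Hence the excess K = c(ρ) − ρ is at least 2M, and c(n) = n + K on the jump-free stretch
-- from ρ to m.  There, an even n must be coprime to K − 1 and an odd n must have
-- gcd(n − 2, K + 1) = 1; a nontrivial factorisation of K − 1 or K + 1 produces an n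
-- violating this inside the stretch as soon as ρ is noticeably smaller than K, which is
-- what λ ≤ 5/4 (ρ ≤ 5(M + 3)/4, against K ≥ 2M) provides.  So K − 1, K + 1 are twin
-- primes beyond M.  Good fundamental points exist beyond every index (an odd fundamental
-- point M is followed by M + 1, an even one with 3 ∣ M + 2 by M + 2), so twin primes
-- exist beyond every bound.
module Submission where

open import Defs
open import Data.Nat hiding (_/_)
open import Data.Nat.Properties
open import Data.Nat.GCD using (gcd; gcd[m,n]∣m; gcd[m,n]∣n; gcd-greatest; gcd[m,n]≢0)
open import Data.Nat.Divisibility
open import Data.Nat.Primality using (Prime; prime; Composite; prime?; prime[2]; prime⇒irreducible)
open import Data.Nat.Tactic.RingSolver using (solve-∀)
open import Data.Product using (_×_; _,_; proj₁; proj₂; ∃-syntax)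
open import Data.Sum using (_⊎_; inj₁; inj₂)
open import Data.Unit using (tt)
open import Data.Integer using (+_)
import Data.Integer as ℤ
import Data.Integer.Properties as ℤP
open import Data.Rational using (_/_) renaming (_≤_ to _≤ℚ_)
open import Data.Rational.Properties using (toℚᵘ-mono-≤; toℚᵘ-fromℚᵘ)
import Data.Rational.Unnormalised as ℚᵘ
import Data.Rational.Unnormalised.Properties as ℚᵘP
open import Data.Empty using (⊥)
open import Data.Nat.Divisibility.Core using (hasNonTrivialDivisor)
open import Relation.Nullary using (¬_; yes; no; contradiction)
open import Relation.Nullary.Decidable using (toWitness)
open import Relation.Binary.Definitions using (tri<; tri≈; tri>)
open import Relation.Binary.PropositionalEquality

even-or-odd : ∀ n → 2 ∣ n ⊎ 2 ∣ suc n
even-or-odd zero = inj₁ (divides 0 refl)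
even-or-odd (suc n) with even-or-odd n
... | inj₁ 2∣n   = inj₂ (∣m∣n⇒∣m+n ∣-refl 2∣n)
... | inj₂ 2∣1+n = inj₁ 2∣1+n

even⇒suc-odd : ∀ {n} → 2 ∣ n → ¬ 2 ∣ suc n
even⇒suc-odd {n} 2∣n 2∣1+n with ∣1⇒≡1 (∣m+n∣m⇒∣n (subst (2 ∣_) (+-comm 1 n) 2∣1+n) 2∣n)
... | ()

odd⇒pred-even : ∀ {n} → ¬ 2 ∣ suc n → 2 ∣ n
odd⇒pred-even {n} 1+n-odd with even-or-odd n
... | inj₁ 2∣n   = 2∣n
... | inj₂ 2∣1+n = contradiction 2∣1+n 1+n-odd

odd⇒≥3 : ∀ {a} → 2 ≤ a → ¬ 2 ∣ a → 3 ≤ a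
odd⇒≥3 {suc zero} (s≤s ()) _
odd⇒≥3 {suc (suc zero)} _ a-odd = contradiction ∣-refl a-odd
odd⇒≥3 {suc (suc (suc _))} _ _ = s≤s (s≤s (s≤s z≤n))

odd-factors : ∀ a b → ¬ 2 ∣ a * b → ¬ 2 ∣ a × ¬ 2 ∣ b
odd-factors a b ab-odd = (λ 2∣a → ab-odd (∣m⇒∣m*n b 2∣a)) , (λ 2∣b → ab-odd (∣n⇒∣m*n a 2∣b))

∣-offset : ∀ {d u v k} → d ∣ u → d ∣ v → u + k ≡ v → d ∣ k
∣-offset d∣u d∣v eq = ∣m+n∣m⇒∣n (subst (_ ∣_) (sym eq) d∣v) d∣u

gcd≥1 : ∀ x {y} → y ≢ 0 → 1 ≤ gcd x y
gcd≥1 x {y} y≢0 = n≢0⇒n>0 (gcd[m,n]≢0 x y (inj₂ y≢0))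

gcd>1 : ∀ {d x y} → 2 ≤ d → y ≢ 0 → d ∣ x → d ∣ y → 1 < gcd x y
gcd>1 {d} {x} {y} d≥2 y≢0 d∣x d∣y = <-≤-trans d≥2 (∣⇒≤ (gcd-greatest d∣x d∣y))
  where
  instance
    gcd-nonZero : NonZero (gcd x y)
    gcd-nonZero = ≢-nonZero (gcd[m,n]≢0 x y (inj₂ y≢0))

gcd∣prime⇒≡1 : ∀ {p x y} → Prime p → gcd x y ∣ p → ¬ p ∣ x → gcd x y ≡ 1
gcd∣prime⇒≡1 {x = x} {y} p-prime g∣p p∤x with prime⇒irreducible p-prime g∣p
... | inj₁ g≡1 = g≡1
... | inj₂ g≡p = contradiction (subst (_∣ x) g≡p (gcd[m,n]∣m x y)) p∤x

prime[3] : Prime 3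
prime[3] = toWitness {a? = prime? 3} tt

prime-by-factorisations : ∀ n → 2 ≤ n → (∀ a b → a * b ≡ n → 2 ≤ a → a ≤ b → ⊥) → Prime n
prime-by-factorisations (suc zero) (s≤s ()) _
prime-by-factorisations n@(suc (suc _)) _ no-factorisation = prime not-composite
  where
  not-composite : ¬ Composite n
  not-composite (hasNonTrivialDivisor {d} d<n d∣n) with ≤-total d (quotient d∣n)
  ... | inj₁ d≤q = no-factorisation d (quotient d∣n) (sym (m∣n⇒n≡m*quotient d∣n)) (nonTrivial⇒n>1 d) d≤q
  ... | inj₂ q≤d = no-factorisation (quotient d∣n) d (sym (m∣n⇒n≡quotient*m d∣n)) (quotient>1 d∣n d<n) q≤d

step-even : ∀ {n} p → 2 ∣ n → step n p ≡ p + gcd n p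
step-even {n} p 2∣n with n % 2 ≟ 0
... | yes _      = refl
... | no n%2≢0   = contradiction (n∣m⇒m%n≡0 n 2 2∣n) n%2≢0

step-odd : ∀ {n} p → ¬ 2 ∣ n → step n p ≡ p + gcd (n ∸ 2) p
step-odd {n} p n-odd with n % 2 ≟ 0
... | yes n%2≡0 = contradiction (m%n≡0⇒n∣m n 2 n%2≡0) n-odd
... | no _      = refl

-- Each step adds a gcd with the (nonzero) previous value, hence at least 1.
step-increasing : ∀ n p → p ≢ 0 → suc p ≤ step n p
step-increasing n p p≢0 with n % 2 ≟ 0
... | yes _ = m<m+n p (gcd≥1 n p≢0)
... | no _  = m<m+n p (gcd≥1 (n ∸ 2) p≢0)

c-suc : ∀ n → 1 ≤ n → c (suc n) ≡ step (suc n) (c n)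
c-suc (suc _) _ = refl

c-positive : ∀ n → 1 ≤ n → c n ≢ 0
c-increasing : ∀ n → 1 ≤ n → suc (c n) ≤ c (suc n)

c-positive (suc zero) _ ()
c-positive (suc (suc k)) _ = m<n⇒n≢0 (c-increasing (suc k) (s≤s z≤n))

c-increasing (suc k) _ = step-increasing (suc (suc k)) (c (suc k)) (c-positive (suc k) (s≤s z≤n))

unit-step : ∀ n → 1 ≤ n → ¬ Jump (suc n) → c (suc n) ≡ suc (c n)
unit-step n n≥1 no-jump = ≤-antisym at-most (c-increasing n n≥1)
  where
  open ≤-Reasoning
  at-most : c (suc n) ≤ suc (c n)
  at-most = begin
    c (suc n)                   ≤⟨ m≤n+m∸n (c (suc n)) (c n) ⟩
    c n + (c (suc n) ∸ c n)     ≤⟨ +-monoʳ-≤ (c n) (≮⇒≥ no-jump) ⟩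
    c n + 1                     ≡⟨ +-comm (c n) 1 ⟩
    suc (c n)                   ∎

excess-mono : ∀ {a K} → 1 ≤ a → a + K ≤ c a → ∀ b → a ≤ b → b + K ≤ c b
excess-mono {a} {K} a≥1 base b a≤b with m≤n⇒m<n∨m≡n a≤b
... | inj₂ refl = base
excess-mono {a} {K} a≥1 base (suc b) _ | inj₁ (s≤s a≤b) = begin
  suc (b + K)     ≤⟨ s≤s (excess-mono a≥1 base b a≤b) ⟩
  suc (c b)       ≤⟨ c-increasing b (≤-trans a≥1 a≤b) ⟩
  c (suc b)       ∎
  where open ≤-Reasoning

flat : ∀ {r m K} → 1 ≤ r → (∀ n → r < n → n < m → ¬ Jump n) → c r ≡ r + K →
       ∀ n → r ≤ n → n < m → c n ≡ n + K
flat {r} r≥1 no-jump base n r≤n n<m with m≤n⇒m<n∨m≡n r≤n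
... | inj₂ refl = base
flat {r} {m} {K} r≥1 no-jump base (suc n) _ n<m | inj₁ (s≤s r≤n) = begin
  c (suc n)       ≡⟨ unit-step n (≤-trans r≥1 r≤n) (no-jump (suc n) (s≤s r≤n) n<m) ⟩
  suc (c n)       ≡⟨ cong suc (flat r≥1 no-jump base n r≤n (<-trans (n<1+n n) n<m)) ⟩
  suc (n + K)     ∎
  where open ≡-Reasoning

jump-of-gcd : ∀ {n g} → c (suc n) ≡ c n + g → 1 < g → Jump (suc n)
jump-of-gcd {n} {g} eq g>1 = subst (1 <_) (sym (trans (cong (_∸ c n) eq) (m+n∸m≡n (c n) g))) g>1

jump-even : ∀ {n d} → 1 ≤ n → 2 ∣ suc n → 2 ≤ d → d ∣ suc n → d ∣ c n → Jump (suc n)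
jump-even {n} n≥1 even d≥2 d∣x d∣c =
  jump-of-gcd {n} (trans (c-suc n n≥1) (step-even (c n) even)) (gcd>1 d≥2 (c-positive n n≥1) d∣x d∣c)

jump-odd : ∀ {n d} → 1 ≤ n → ¬ 2 ∣ suc n → 2 ≤ d → d ∣ n ∸ 1 → d ∣ c n → Jump (suc n)
jump-odd {n} n≥1 odd d≥2 d∣x d∣c =
  jump-of-gcd {n} (trans (c-suc n n≥1) (step-odd (c n) odd)) (gcd>1 d≥2 (c-positive n n≥1) d∣x d∣c)

-- A flat stretch with excess K that ends at a fundamental point m has K ≤ m:
-- c(m) = 2m, while c(m) ≥ c(m − 1) + 1 = m + K.
excess≤fund : ∀ {r m K} → 1 ≤ r → r < m → c m ≡ 2 * m →
              (∀ n → r ≤ n → n < m → c n ≡ n + K) → K ≤ m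
excess≤fund {r} {suc n} {K} r≥1 (s≤s r≤n) fund value = +-cancelˡ-≤ (suc n) K (suc n) (begin
  suc (n + K)       ≡⟨ cong suc (sym (value n r≤n ≤-refl)) ⟩
  suc (c n)         ≤⟨ c-increasing n (≤-trans r≥1 r≤n) ⟩
  c (suc n)         ≡⟨ fund ⟩
  2 * suc n         ≡⟨ double (suc n) ⟩
  suc n + suc n     ∎)
  where
  open ≤-Reasoning
  double : ∀ x → 2 * x ≡ x + x
  double = solve-∀

-- The linear estimates placing the factor-built positions inside the stretch.
module StretchArithmetic {r P : ℕ} (short : 3 * suc r ≤ 2 * P) (P≥18 : 18 ≤ P) where
  open ≤-Reasoning

  r+7≤P : 7 + r ≤ P
  r+7≤P = *-cancelˡ-≤ 3 (begin
    3 * (7 + r)       ≡⟨ e r ⟩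
    18 + 3 * suc r    ≤⟨ +-mono-≤ P≥18 short ⟩
    P + 2 * P         ≡⟨ f P ⟩
    3 * P             ∎)
    where
    e : ∀ r → 3 * (7 + r) ≡ 18 + 3 * suc r
    e = solve-∀
    f : ∀ P → P + 2 * P ≡ 3 * P
    f = solve-∀

  even-position : ∀ {x a} → x + a ≡ P → 3 * a ≤ P → r < x
  even-position {x} {a} x+a≡P 3a≤P = *-cancelˡ-≤ 3 (+-cancelʳ-≤ (3 * a) (3 * suc r) (3 * x) (begin
    3 * suc r + 3 * a   ≤⟨ +-mono-≤ short 3a≤P ⟩
    2 * P + P           ≡⟨ e P ⟩
    3 * P               ≡⟨ cong (3 *_) (sym x+a≡P) ⟩
    3 * (x + a)         ≡⟨ *-distribˡ-+ 3 x a ⟩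
    3 * x + 3 * a       ∎))
    where
    e : ∀ P → 2 * P + P ≡ 3 * P
    e = solve-∀

  odd-position : ∀ {y a} → y + 2 * a ≡ P + 2 → a ≤ 5 ⊎ 6 * a ≤ P + 2 → r < 2 + y
  odd-position {y} {a} y+2a≡P+2 (inj₁ a≤5) = +-cancelʳ-≤ (2 * a) (suc r) (2 + y) (begin
    suc r + 2 * a       ≤⟨ +-monoʳ-≤ (suc r) (*-monoʳ-≤ 2 a≤5) ⟩
    suc r + 10          ≡⟨ e r ⟩
    4 + (7 + r)         ≤⟨ +-monoʳ-≤ 4 r+7≤P ⟩
    4 + P               ≡⟨ cong (λ z → 2 + z) (trans (+-comm 2 P) (sym y+2a≡P+2)) ⟩
    2 + (y + 2 * a)     ≡⟨ sym (+-assoc 2 y (2 * a)) ⟩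
    2 + y + 2 * a       ∎)
    where
    e : ∀ r → suc r + 10 ≡ 4 + (7 + r)
    e = solve-∀
  odd-position {y} {a} y+2a≡P+2 (inj₂ 6a≤P+2) =
    *-cancelˡ-≤ 3 (+-cancelʳ-≤ (6 * a) (3 * suc r) (3 * (2 + y)) (begin
      3 * suc r + 6 * a     ≤⟨ +-mono-≤ short 6a≤P+2 ⟩
      2 * P + (P + 2)       ≤⟨ m≤m+n (2 * P + (P + 2)) 10 ⟩
      2 * P + (P + 2) + 10  ≡⟨ e P ⟩
      3 * (2 + (P + 2))     ≡⟨ cong (λ z → 3 * (2 + z)) (sym y+2a≡P+2) ⟩
      3 * (2 + (y + 2 * a)) ≡⟨ f y a ⟩
      3 * (2 + y) + 6 * a   ∎))
    where
    e : ∀ P → 2 * P + (P + 2) + 10 ≡ 3 * (2 + (P + 2))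
    e = solve-∀
    f : ∀ y a → 3 * (2 + (y + 2 * a)) ≡ 3 * (2 + y) + 6 * a
    f = solve-∀

odd-position-below : ∀ {P y a} → y + 2 * a ≡ P + 2 → 3 ≤ a → 2 + y < P
odd-position-below {P} {y} {a} y+2a≡P+2 a≥3 = +-cancelʳ-≤ 3 (3 + y) P (begin
  3 + y + 3       ≡⟨ e y ⟩
  y + 2 * 3       ≤⟨ +-monoʳ-≤ y (*-monoʳ-≤ 2 a≥3) ⟩
  y + 2 * a       ≡⟨ y+2a≡P+2 ⟩
  P + 2           ≤⟨ +-monoʳ-≤ P (n≤1+n 2) ⟩
  P + 3           ∎)
  where
  open ≤-Reasoning
  e : ∀ y → 3 + y + 3 ≡ y + 2 * 3
  e = solve-∀

-- Suppose c(r) = r + P + 1, no jump occurs strictly between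
-- r and the fundamental point m, and r is small compared to P.  Then c(n) = n + P + 1 on
-- the whole stretch, so for even n the gcd(n, c(n − 1)) = gcd(n, P) must be 1 and for
-- odd n the gcd(n − 2, c(n − 1)) = gcd(n − 2, P + 2) must be 1.  A factorisation
-- P = a·b (resp. P + 2 = a·b) with 3 ≤ a ≤ b yields an n in the stretch violating this,
-- namely n = a(b − 1) (resp. n = a(b − 2) + 2); hence P and P + 2 are twin primes.
module FlatStretch {r m P : ℕ} (r≥1 : 1 ≤ r) (r<m : r < m) (m-fund : c m ≡ 2 * m)
  (no-jump : ∀ n → r < n → n < m → ¬ Jump n) (c[r] : c r ≡ r + suc P)
  (short : 3 * suc r ≤ 2 * P) (P≥18 : 18 ≤ P) where

  open StretchArithmetic short P≥18

  value : ∀ n → r ≤ n → n < m → c n ≡ n + suc P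
  value = flat r≥1 no-jump c[r]

  -- Every number up to P lies below m, since P + 1 ≤ m.
  below-m : ∀ {x} → x ≤ P → x < m
  below-m x≤P = ≤-trans (s≤s x≤P) (excess≤fund r≥1 r<m m-fund value)

  -- An even n in the stretch has c(n − 1) = n + P, so it shares no divisor d ≥ 2 with P.
  no-even-divisor : ∀ x d → r < x → x < m → 2 ∣ x → 2 ≤ d → d ∣ x → d ∣ P → ⊥
  no-even-divisor (suc n) d (s≤s r≤n) x<m x-even d≥2 d∣x d∣P =
    no-jump (suc n) (s≤s r≤n) x<m (jump-even (≤-trans r≥1 r≤n) x-even d≥2 d∣x d∣c[n])
    where
    d∣c[n] : d ∣ c n
    d∣c[n] = subst (d ∣_) (sym (trans (value n r≤n (<-trans (n<1+n n) x<m)) (+-suc n P)))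
                   (∣m∣n⇒∣m+n d∣x d∣P)

  -- An odd n = 2 + y in the stretch has c(n − 1) = y + (P + 2), so no divisor d ≥ 2 of y
  -- divides P + 2.
  no-odd-divisor : ∀ y d → r < 2 + y → 2 + y < m → ¬ 2 ∣ 2 + y → 2 ≤ d → d ∣ y → d ∣ P + 2 → ⊥
  no-odd-divisor y d (s≤s r≤1+y) x<m x-odd d≥2 d∣y d∣P+2 =
    no-jump (2 + y) (s≤s r≤1+y) x<m (jump-odd (s≤s z≤n) x-odd d≥2 d∣y d∣c[1+y])
    where
    shift : ∀ y P → suc y + suc P ≡ y + (P + 2)
    shift = solve-∀
    d∣c[1+y] : d ∣ c (suc y)
    d∣c[1+y] = subst (d ∣_) (sym (trans (value (suc y) r≤1+y (<-trans (n<1+n _) x<m)) (shift y P)))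
                     (∣m∣n⇒∣m+n d∣y d∣P+2)

  -- P is odd: otherwise the even one of r + 1, r + 2 would share the divisor 2 with P.
  P-odd : ¬ 2 ∣ P
  P-odd 2∣P with even-or-odd (suc r)
  ... | inj₁ 2∣1+r = no-even-divisor (suc r) 2 ≤-refl (below-m (≤-trans (m≤n+m (suc r) 6) r+7≤P))
                       2∣1+r ≤-refl 2∣1+r 2∣P
  ... | inj₂ 2∣2+r = no-even-divisor (2 + r) 2 (n≤1+n (suc r)) (below-m (≤-trans (m≤n+m (2 + r) 5) r+7≤P))
                       2∣2+r ≤-refl 2∣2+r 2∣P

  P-prime : Prime P
  P-prime = prime-by-factorisations P (≤-trans (m≤n+m 2 16) P≥18) no-factorisation
    where
    no-factorisation : ∀ a b → a * b ≡ P → 2 ≤ a → a ≤ b → ⊥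
    no-factorisation a zero _ a≥2 a≤0 = contradiction (≤-trans a≥2 a≤0) λ ()
    no-factorisation a (suc b′) ab≡P a≥2 a≤b =
      no-even-divisor (a * b′) a (even-position x+a≡P 3a≤P) (below-m (≤-trans (m≤m+n (a * b′) a) (≤-reflexive x+a≡P)))
        x-even a≥2 (m∣m*n b′) (divides (suc b′) (trans (sym ab≡P) (*-comm a (suc b′))))
      where
      factors-odd : ¬ 2 ∣ a × ¬ 2 ∣ suc b′
      factors-odd = odd-factors a (suc b′) (subst (λ z → ¬ 2 ∣ z) (sym ab≡P) P-odd)
      x-even : 2 ∣ a * b′
      x-even = ∣n⇒∣m*n a (odd⇒pred-even (proj₂ factors-odd))
      x+a≡P : a * b′ + a ≡ P
      x+a≡P = trans (+-comm (a * b′) a) (trans (sym (*-suc a b′)) ab≡P)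
      3a≤P : 3 * a ≤ P
      3a≤P = ≤-trans (≤-reflexive (*-comm 3 a))
               (≤-trans (*-monoʳ-≤ a (≤-trans (odd⇒≥3 a≥2 (proj₁ factors-odd)) a≤b)) (≤-reflexive ab≡P))

  P+2-prime : Prime (P + 2)
  P+2-prime = prime-by-factorisations (P + 2) (m≤n+m 2 P) no-factorisation
    where
    P+2-odd : ¬ 2 ∣ P + 2
    P+2-odd 2∣P+2 = P-odd (∣m+n∣m⇒∣n (subst (2 ∣_) (+-comm P 2) 2∣P+2) ∣-refl)
    no-factorisation : ∀ a b → a * b ≡ P + 2 → 2 ≤ a → a ≤ b → ⊥
    no-factorisation a zero _ a≥2 a≤0 = contradiction (≤-trans a≥2 a≤0) λ ()
    no-factorisation a (suc zero) _ a≥2 a≤1 = contradiction (≤-trans a≥2 a≤1) λ { (s≤s ()) }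
    no-factorisation a (suc (suc b′)) ab≡P+2 a≥2 a≤b =
      no-odd-divisor (a * b′) a (odd-position y+2a≡P+2 small-or-large)
        (below-m (<⇒≤ (odd-position-below y+2a≡P+2 a≥3))) x-odd a≥2 (m∣m*n b′)
        (divides (2 + b′) (trans (sym ab≡P+2) (*-comm a (2 + b′))))
      where
      expand : ∀ a b′ → a * b′ + 2 * a ≡ a * (2 + b′)
      expand = solve-∀
      y+2a≡P+2 : a * b′ + 2 * a ≡ P + 2
      y+2a≡P+2 = trans (expand a b′) ab≡P+2
      a≥3 : 3 ≤ a
      a≥3 = odd⇒≥3 a≥2 (proj₁ (odd-factors a (2 + b′) (subst (λ z → ¬ 2 ∣ z) (sym ab≡P+2) P+2-odd)))
      x-odd : ¬ 2 ∣ 2 + a * b′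
      x-odd 2∣x = P+2-odd (subst (2 ∣_) y+2a≡P+2
                    (∣m∣n⇒∣m+n (∣m+n∣m⇒∣n 2∣x ∣-refl) (m∣m*n a)))
      small-or-large : a ≤ 5 ⊎ 6 * a ≤ P + 2
      small-or-large with a ≤? 5
      ... | yes a≤5 = inj₁ a≤5
      ... | no a≰5  = inj₂ (≤-trans (*-monoˡ-≤ a (≰⇒> a≰5))
                              (≤-trans (*-monoʳ-≤ a a≤b) (≤-reflexive ab≡P+2)))

  -- P = a(b − 1) + a with n = a(b − 1) even in the stretch; P + 2 = a(b − 2) + 2a with
  -- n = a(b − 2) + 2 odd in the stretch (here a small factor or 6a ≤ P + 2 is used).
  twins : Prime P × Prime (P + 2)
  twins = P-prime , P+2-prime

-- Right after an even fundamental point M the sequence is forced: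
-- c(M + 1) = 2M + 1 and c(M + 2) = 2M + 1 + g with g = gcd(M + 2, 2M + 1) dividing 3.
module AfterEvenFundamental {M : ℕ} (M-fund : Fund M) (M-even : 2 ∣ M) where
  open ≡-Reasoning

  M≥1 : 1 ≤ M
  M≥1 = proj₁ M-fund

  c[M+1] : c (suc M) ≡ suc (2 * M)
  c[M+1] = begin
    c (suc M)                     ≡⟨ c-suc M M≥1 ⟩
    step (suc M) (c M)            ≡⟨ cong (step (suc M)) (proj₂ M-fund) ⟩
    step (suc M) (2 * M)          ≡⟨ step-odd (2 * M) (even⇒suc-odd M-even) ⟩
    2 * M + gcd (M ∸ 1) (2 * M)   ≡⟨ cong (λ z → 2 * M + z) g≡1 ⟩
    2 * M + 1                     ≡⟨ +-comm (2 * M) 1 ⟩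
    suc (2 * M)                   ∎
    where
    M-1+1 : suc (M ∸ 1) ≡ M
    M-1+1 = m+[n∸m]≡n M≥1
    double-suc : ∀ x → 2 * x + 2 ≡ 2 * suc x
    double-suc = solve-∀
    -- gcd(M − 1, 2M) divides 2M − 2(M − 1) = 2, and M − 1 is odd.
    g≡1 : gcd (M ∸ 1) (2 * M) ≡ 1
    g≡1 = gcd∣prime⇒≡1 prime[2]
            (∣-offset (∣n⇒∣m*n 2 (gcd[m,n]∣m (M ∸ 1) (2 * M))) (gcd[m,n]∣n (M ∸ 1) (2 * M))
                      (trans (double-suc (M ∸ 1)) (cong (2 *_) M-1+1)))
            (λ 2∣M-1 → even⇒suc-odd 2∣M-1 (subst (2 ∣_) (sym M-1+1) M-even))

  -- M + 1 is not fundamental: c(M + 1) is odd.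
  M+1-not-fund : ¬ Fund (suc M)
  M+1-not-fund (_ , c[M+1]≡) = even≢odd (suc M) M (trans (sym c[M+1]≡) c[M+1])

  M+2-even : 2 ∣ 2 + M
  M+2-even = ∣m∣n⇒∣m+n ∣-refl M-even

  g : ℕ
  g = gcd (2 + M) (suc (2 * M))

  c[M+2]-via-g : c (2 + M) ≡ suc (2 * M) + g
  c[M+2]-via-g = begin
    c (2 + M)                     ≡⟨ c-suc (suc M) (s≤s z≤n) ⟩
    step (2 + M) (c (suc M))      ≡⟨ cong (step (2 + M)) c[M+1] ⟩
    step (2 + M) (suc (2 * M))    ≡⟨ step-even (suc (2 * M)) M+2-even ⟩
    suc (2 * M) + g               ∎

  -- 2(M + 2) − (2M + 1) = 3, so g divides 3.
  gap : suc (2 * M) + 3 ≡ 2 * (2 + M)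
  gap = e M
    where
    e : ∀ M → suc (2 * M) + 3 ≡ 2 * (2 + M)
    e = solve-∀

  g∣3 : g ∣ 3
  g∣3 = ∣-offset (gcd[m,n]∣n (2 + M) (suc (2 * M))) (∣n⇒∣m*n 2 (gcd[m,n]∣m (2 + M) (suc (2 * M)))) gap

  M+2-fund : 3 ∣ 2 + M → Fund (2 + M)
  M+2-fund 3∣M+2 = s≤s z≤n , (begin
    c (2 + M)           ≡⟨ c[M+2]-via-g ⟩
    suc (2 * M) + g     ≡⟨ cong (λ z → suc (2 * M) + z) g≡3 ⟩
    suc (2 * M) + 3     ≡⟨ gap ⟩
    2 * (2 + M)         ∎)
    where
    3∣2M+1 : 3 ∣ suc (2 * M)
    3∣2M+1 = ∣m+n∣m⇒∣n (subst (3 ∣_) (trans (sym gap) (+-comm _ 3)) (∣n⇒∣m*n 2 3∣M+2)) ∣-refl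
    g≡3 : g ≡ 3
    g≡3 = ∣-antisym g∣3 (gcd-greatest 3∣M+2 3∣2M+1)

-- After a good fundamental point (even, with 3 ∤ M + 2):
-- c(M + 2) = 2M + 2 and c(M + 3) = 3M + 3, a jump of M + 1.
module AfterGoodFundamental {M : ℕ} (M-fund : Fund M) (M-even : 2 ∣ M) (3∤M+2 : ¬ 3 ∣ 2 + M) where
  open AfterEvenFundamental M-fund M-even
  open ≡-Reasoning

  c[M+2] : c (2 + M) ≡ 2 * suc M
  c[M+2] = begin
    c (2 + M)           ≡⟨ c[M+2]-via-g ⟩
    suc (2 * M) + g     ≡⟨ cong (λ z → suc (2 * M) + z) g≡1 ⟩
    suc (2 * M) + 1     ≡⟨ e M ⟩
    2 * suc M           ∎
    where
    e : ∀ M → suc (2 * M) + 1 ≡ 2 * suc M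
    e = solve-∀
    g≡1 : g ≡ 1
    g≡1 = gcd∣prime⇒≡1 {y = suc (2 * M)} prime[3] g∣3 3∤M+2

  c[M+3] : c (3 + M) ≡ 2 * suc M + suc M
  c[M+3] = begin
    c (3 + M)                                 ≡⟨ c-suc (2 + M) (s≤s z≤n) ⟩
    step (3 + M) (c (2 + M))                  ≡⟨ cong (step (3 + M)) c[M+2] ⟩
    step (3 + M) (2 * suc M)                  ≡⟨ step-odd (2 * suc M) (even⇒suc-odd M+2-even) ⟩
    2 * suc M + gcd (suc M) (2 * suc M)       ≡⟨ cong (λ z → 2 * suc M + z) gcd≡ ⟩
    2 * suc M + suc M                         ∎
    where
    gcd≡ : gcd (suc M) (2 * suc M) ≡ suc M
    gcd≡ = ∣-antisym (gcd[m,n]∣m (suc M) (2 * suc M)) (gcd-greatest ∣-refl (n∣m*n 2))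

  jump[M+3] : Jump (3 + M)
  jump[M+3] = jump-of-gcd {2 + M} (trans c[M+3] (cong (λ z → z + suc M) (sym c[M+2]))) (s≤s M≥1)

  -- None of M + 1, M + 2, M + 3 is fundamental (the last one because M ≠ 3).
  next-fund-beyond : ∀ {m} → 4 ≤ M → M < m → c m ≡ 2 * m → 3 + M < m
  next-fund-beyond {m} M≥4 M<m m-fund =
    ≤∧≢⇒< (≤∧≢⇒< (≤∧≢⇒< M<m (not-at (λ eq → M+1-not-fund (s≤s z≤n , eq))))
                   (not-at M+2-not-fund))
          (not-at M+3-not-fund)
    where
    not-at : ∀ {n} → c n ≢ 2 * n → n ≢ m
    not-at c[n]≢ refl = c[n]≢ m-fund
    M+2-not-fund : c (2 + M) ≢ 2 * (2 + M)
    M+2-not-fund eq = 1+n≢n (sym (*-cancelˡ-≡ (suc M) (2 + M) 2 (trans (sym c[M+2]) eq)))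
    normal : ∀ M → 2 * suc M + suc M ≡ M + (3 + 2 * M)
    normal = solve-∀
    normal′ : ∀ M → 2 * (3 + M) ≡ 3 + (3 + 2 * M)
    normal′ = solve-∀
    M+3-not-fund : c (3 + M) ≢ 2 * (3 + M)
    M+3-not-fund eq = <⇒≢ M≥4 (sym (+-cancelʳ-≡ (3 + 2 * M) M 3
                        (trans (sym (normal M)) (trans (sym c[M+3]) (trans eq (normal′ M))))))

-- If M is fundamental and M + 1 is even, then M + 1 is fundamental too: gcd(M + 1, 2M) = 2.
fund⇒suc-fund : ∀ {M} → Fund M → 2 ∣ suc M → Fund (suc M)
fund⇒suc-fund {M} (M≥1 , c[M]) 2∣M+1 = s≤s z≤n , (begin
  c (suc M)                     ≡⟨ c-suc M M≥1 ⟩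
  step (suc M) (c M)            ≡⟨ cong (step (suc M)) c[M] ⟩
  step (suc M) (2 * M)          ≡⟨ step-even (2 * M) 2∣M+1 ⟩
  2 * M + gcd (suc M) (2 * M)   ≡⟨ cong (λ z → 2 * M + z) g≡2 ⟩
  2 * M + 2                     ≡⟨ gap M ⟩
  2 * suc M                     ∎)
  where
  open ≡-Reasoning
  gap : ∀ M → 2 * M + 2 ≡ 2 * suc M
  gap = solve-∀
  g≡2 : gcd (suc M) (2 * M) ≡ 2
  g≡2 = ∣-antisym (∣-offset (gcd[m,n]∣n (suc M) (2 * M)) (∣n⇒∣m*n 2 (gcd[m,n]∣m (suc M) (2 * M))) (gap M))
                  (gcd-greatest 2∣M+1 (m∣m*n M))

fund-of : ∀ {i m} → NthFund i m → Fund m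
fund-of (first fund _)    = fund
fund-of (next _ _ fund _) = fund

index≤ : ∀ {i m} → NthFund i m → i ≤ m
index≤ (first (m≥1 , _) _) = m≥1
index≤ (next m′-th m′<m _ _) = ≤-<-trans (index≤ m′-th) m′<m

nthFund-unique : ∀ {i a b} → NthFund i a → NthFund i b → a ≡ b
nthFund-unique (first a-fund a-min) (first b-fund b-min) with <-cmp _ _
... | tri< a<b _ _ = contradiction a-fund (b-min _ a<b)
... | tri≈ _ a≡b _ = a≡b
... | tri> _ _ b<a = contradiction b-fund (a-min _ b<a)
nthFund-unique (next p-th p<a a-fund a-min) (next q-th q<b b-fund b-min)
  with nthFund-unique p-th q-th
... | refl with <-cmp _ _
...   | tri< a<b _ _ = contradiction a-fund (b-min _ p<a a<b)
...   | tri≈ _ a≡b _ = a≡b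
...   | tri> _ _ b<a = contradiction b-fund (a-min _ q<b b<a)

nthFund-next : ∀ {j M m} → NthFund j M → NthFund (suc j) m → M < m × Fund m
nthFund-next M-th (next M′-th M′<m m-fund _) with nthFund-unique M′-th M-th
... | refl = M′<m , m-fund

Good : ℕ → Set
Good M = Fund M × 2 ∣ M × ¬ 3 ∣ 2 + M

GoodBeyond : ℕ → ℕ → Set
GoodBeyond j M = ∃[ j′ ] ∃[ M′ ] (j ≤ j′ × M ≤ M′ × NthFund j′ M′ × Good M′)

good-from-even : ∀ {j M} → NthFund j M → 2 ∣ M → GoodBeyond j M
good-from-even {j} {M} M-th M-even with 3 ∣? (2 + M)
... | no 3∤M+2 = j , M , ≤-refl , ≤-refl , M-th , (fund-of M-th , M-even , 3∤M+2)
... | yes 3∣M+2 = suc j , 2 + M , n≤1+n j , m≤n+m M 2 ,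
                  next M-th (n≤1+n (suc M)) (M+2-fund 3∣M+2) none-between ,
                  (M+2-fund 3∣M+2 , M+2-even , 3∤M+4)
  where
  open AfterEvenFundamental (fund-of M-th) M-even
  none-between : ∀ y → M < y → y < 2 + M → ¬ Fund y
  none-between y M<y y<M+2 y-fund with ≤-antisym (s≤s⁻¹ y<M+2) M<y
  ... | refl = M+1-not-fund y-fund
  3∤M+4 : ¬ 3 ∣ 2 + (2 + M)
  3∤M+4 3∣M+4 with ∣⇒≤ (∣m+n∣m⇒∣n (subst (3 ∣_) (+-comm 2 (2 + M)) 3∣M+4) 3∣M+2)
  ... | s≤s (s≤s ())

good-beyond : ∀ {j M} → NthFund j M → GoodBeyond j M
good-beyond {j} {M} M-th with even-or-odd M
... | inj₁ M-even   = good-from-even M-th M-even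
... | inj₂ M+1-even = later (good-from-even M+1-th M+1-even)
  where
  M+1-th : NthFund (suc j) (suc M)
  M+1-th = next M-th ≤-refl (fund⇒suc-fund (fund-of M-th) M+1-even)
                (λ y M<y y<M+1 _ → <⇒≱ y<M+1 M<y)
  later : GoodBeyond (suc j) (suc M) → GoodBeyond j M
  later (j′ , M′ , j+1≤j′ , M+1≤M′ , found) = j′ , M′ , ≤-trans (n≤1+n j) j+1≤j′ , ≤-trans (n≤1+n M) M+1≤M′ , found

fraction-≤ : ∀ a b c d → (+ a) / suc b ≤ℚ (+ c) / suc d → a * suc d ≤ c * suc b
fraction-≤ a b c d a/b≤c/d
  with ℚᵘP.≤-respʳ-≃ (toℚᵘ-fromℚᵘ (ℚᵘ.mkℚᵘ (+ c) d))
         (ℚᵘP.≤-respˡ-≃ (toℚᵘ-fromℚᵘ (ℚᵘ.mkℚᵘ (+ a) b)) (toℚᵘ-mono-≤ a/b≤c/d))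
... | ℚᵘ.*≤* cross =
  ℤP.drop‿+≤+ (subst₂ ℤ._≤_ (sym (ℤP.pos-* a (suc d))) (sym (ℤP.pos-* c (suc b))) cross)

-- What λ ≤ 5/4 gives numerically: with ρ ≤ 5(M + 3)/4, M ≥ 65 and an excess
-- P + 1 ≥ 2M, the stretch after ρ is long enough for the flat-stretch argument.
module RatioArithmetic {M r P : ℕ} (ratio : r * 4 ≤ 5 * (3 + M)) (M≥65 : 65 ≤ M)
  (2M≤P+1 : 2 * M ≤ suc P) where
  open ≤-Reasoning

  short : 3 * suc r ≤ 2 * P
  short = *-cancelˡ-≤ 4 (+-cancelˡ-≤ 8 (4 * (3 * suc r)) (4 * (2 * P)) (begin
    8 + 4 * (3 * suc r)       ≡⟨ e r ⟩
    20 + 3 * (r * 4)          ≤⟨ +-monoʳ-≤ 20 (*-monoʳ-≤ 3 ratio) ⟩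
    20 + 3 * (5 * (3 + M))    ≡⟨ f M ⟩
    65 + 15 * M               ≤⟨ +-monoˡ-≤ (15 * M) M≥65 ⟩
    M + 15 * M                ≡⟨ g M ⟩
    8 * (2 * M)               ≤⟨ *-monoʳ-≤ 8 2M≤P+1 ⟩
    8 * suc P                 ≡⟨ h P ⟩
    8 + 4 * (2 * P)           ∎))
    where
    e : ∀ r → 8 + 4 * (3 * suc r) ≡ 20 + 3 * (r * 4)
    e = solve-∀
    f : ∀ M → 20 + 3 * (5 * (3 + M)) ≡ 65 + 15 * M
    f = solve-∀
    g : ∀ M → M + 15 * M ≡ 8 * (2 * M)
    g = solve-∀
    h : ∀ P → 8 * suc P ≡ 8 + 4 * (2 * P)
    h = solve-∀

  M≤P : M ≤ P
  M≤P = s≤s⁻¹ (begin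
    suc M       ≡⟨ +-comm 1 M ⟩
    M + 1       ≤⟨ +-monoʳ-≤ M (≤-trans (s≤s z≤n) M≥65) ⟩
    M + M       ≡⟨ double M ⟩
    2 * M       ≤⟨ 2M≤P+1 ⟩
    suc P       ∎)
    where
    double : ∀ M → M + M ≡ 2 * M
    double = solve-∀

  P≥18 : 18 ≤ P
  P≥18 = ≤-trans (≤-trans (m≤m+n 18 47) M≥65) M≤P

-- Since c(M + 3) − c(M + 2) = M + 1, the last
-- jump ρ before the next fundamental point m satisfies ρ ≥ M + 3, so the excess
-- c(ρ) − ρ = P + 1 is at least c(M + 3) − (M + 3) = 2M; with ρ ≤ 5(M + 3)/4 the flat
-- stretch from ρ to m then makes P and P + 2 prime.
twins-after-good : ∀ {M m r} → Good M → 65 ≤ M → M < m → Fund m → IsRho m r →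
                   r * 4 ≤ 5 * (3 + M) → ∃[ p ] (M ≤ p × Prime p × Prime (p + 2))
twins-after-good {M} {m} {r} (M-fund , M-even , 3∤M+2) M≥65 M<m (_ , c[m]) (_ , r<m , _ , no-jump) ratio =
  P , M≤P , FlatStretch.twins r≥1 r<m c[m] no-jump c[r] short P≥18
  where
  open AfterGoodFundamental M-fund M-even 3∤M+2
  M+3≤r : 3 + M ≤ r
  M+3≤r = ≮⇒≥ λ r<M+3 → no-jump (3 + M) r<M+3 (next-fund-beyond (≤-trans (m≤m+n 4 61) M≥65) M<m c[m]) jump[M+3]
  r≥1 : 1 ≤ r
  r≥1 = ≤-trans (s≤s z≤n) M+3≤r
  excess-at-M+3 : ∀ M → 3 + M + 2 * M ≡ 2 * suc M + suc M
  excess-at-M+3 = solve-∀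
  excess : r + 2 * M ≤ c r
  excess = excess-mono (s≤s z≤n) (≤-reflexive (trans (excess-at-M+3 M) (sym c[M+3]))) r M+3≤r
  1+r≤c[r] : suc r ≤ c r
  1+r≤c[r] = ≤-trans (≤-reflexive (+-comm 1 r))
               (≤-trans (+-monoʳ-≤ r (≤-trans (proj₁ M-fund) (m≤m+n M (M + 0)))) excess)
  P : ℕ
  P = c r ∸ suc r
  c[r] : c r ≡ r + suc P
  c[r] = trans (sym (m+[n∸m]≡n 1+r≤c[r])) (sym (+-suc r P))
  open RatioArithmetic {r = r} ratio M≥65 (+-cancelˡ-≤ r (2 * M) (suc P) (≤-trans excess (≤-reflexive c[r])))

Conjecture4 : Set
Conjecture4 = ∀ i → 6 ≤ i → ∃[ m ] ∃[ m′ ] ∃[ r ]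
                (NthFund i m × NthFund (i ∸ 1) m′ × IsRho m r
                  × ((+ r) / (3 + m′)) ≤ℚ ((+ 5) / 4))

TwinPrimeBeyond : ℕ → Set
TwinPrimeBeyond N = ∃[ p ] (N ≤ p × Prime p × Prime (p + 2))

-- Applying the conjecture right after a good fundamental point M = mⱼ (j ≥ 5):
-- its mⱼ₊₁ lies beyond M, its mⱼ is M itself, and λⱼ₊₁ ≤ 5/4 bounds ρ.
twins-from-conjecture : Conjecture4 → ∀ {j M} → 5 ≤ j → 65 ≤ M → NthFund j M → Good M →
                        TwinPrimeBeyond M
twins-from-conjecture conjecture {j} {M} j≥5 M≥65 M-th M-good
  with conjecture (suc j) (s≤s j≥5)
... | m , m′ , r , m-th , m′-th , rho , ratio =
  twins-after-good M-good M≥65 (proj₁ (nthFund-next M-th m-th)) (proj₂ (nthFund-next M-th m-th)) rho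
    (subst (λ z → r * 4 ≤ 5 * (3 + z)) (nthFund-unique m′-th M-th) (fraction-≤ r (2 + m′) 5 3 ratio))

beyond-mono : ∀ {N M} → N ≤ M → TwinPrimeBeyond M → TwinPrimeBeyond N
beyond-mono N≤M (p , M≤p , twin) = p , ≤-trans N≤M M≤p , twin

-- Under the conjecture there are twin primes beyond every index j₀ ≥ 65: take the good
-- fundamental point found beyond m_{j₀} ≥ j₀.
twins-beyond : Conjecture4 → ∀ j₀ → 65 ≤ j₀ → TwinPrimeBeyond j₀
twins-beyond conjecture j₀ j₀≥65 =
  let (M₀ , _ , _ , M₀-th , _)              = conjecture j₀ (≤-trans (m≤m+n 6 59) j₀≥65)
      (j , M , j₀≤j , M₀≤M , M-th , M-good) = good-beyond M₀-th
      j₀≤M                                 = ≤-trans (index≤ M₀-th) M₀≤M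
  in beyond-mono j₀≤M (twins-from-conjecture conjecture (≤-trans (≤-trans (m≤m+n 5 60) j₀≥65) j₀≤j)
                         (≤-trans j₀≥65 j₀≤M) M-th M-good)

theorem4 : (∀ i → 6 ≤ i → ∃[ m ] ∃[ m′ ] ∃[ r ]
               (NthFund i m × NthFund (i ∸ 1) m′ × IsRho m r
                 × ((+ r) / (3 + m′)) ≤ℚ ((+ 5) / 4)))
           → ∀ N → ∃[ p ] (N ≤ p × Prime p × Prime (p + 2))
theorem4 conjecture N = beyond-mono (m≤m+n N 65) (twins-beyond conjecture (N + 65) (m≤n+m 65 N))
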